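{- Let $G$ be a graph with $n=|V(G)|$ vertices, let $I$ and $J$ be independent sets of $G$ with $|I|=|J|$, and let $\mu<|I|$ be a non-negative integer, and set $k=|I|-\mu\ge 1$. If $I$ and $J$ are reconfigurable under $k$-$\mathsf{TJ}$, then the length of a shortest reconfiguration sequence between $I$ and $J$ under $k$-$\mathsf{TJ}$ is at most $O\!\left(\left(\frac{n}{k}\right)^{\mu}\right)$.
   Context: All graphs are finite, simple and undirected. For two vertex subsets $A,B$ of $G$ with $|A|=|B|$, $A$ and $B$ are adjacent under $k$-Token Jumping ($k$-$\mathsf{TJ}$) if $|A\triangle B|\le 2k$. A reconfiguration sequence between independent sets $I$ and $J$ under $k$-$\mathsf{TJ}$ is a sequence $I=I_0,I_1,\dots,I_\ell=J$ of independent sets of $G$ in which consecutive sets are adjacent under $k$-$\mathsf{TJ}$; $\ell$ is its length. $I$ and $J$ are reconfigurable if such a sequence exists. -}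

module Defs where

open import Data.Nat using (ℕ; suc; _≤_; _*_)
open import Data.Fin using (Fin; zero; suc; fromℕ; inject₁)
open import Data.Fin.Subset using (Subset; _∈_; ∣_∣)
open import Data.Bool using (Bool; _xor_)
open import Data.Vec using (zipWith)
open import Data.Product using (Σ; _×_)
open import Relation.Binary.PropositionalEquality using (_≡_)
open import Relation.Nullary using (¬_)

record Graph (n : ℕ) : Set₁ where
  field
    Adj   : Fin n → Fin n → Set
    sym   : ∀ {u v} → Adj u v → Adj v u
    irrefl : ∀ {v} → ¬ Adj v v
open Graph public

_△_ : ∀ {n} → Subset n → Subset n → Subset n
A △ B = zipWith _xor_ A B

Independent : ∀ {n} → Graph n → Subset n → Set
Independent G A = ∀ u v → u ∈ A → v ∈ A → ¬ Adj G u v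

TJAdjacent : ∀ {n} → ℕ → Subset n → Subset n → Set
TJAdjacent k A B = (∣ A ∣ ≡ ∣ B ∣) × (∣ A △ B ∣ ≤ 2 * k)

record ReconfSeq {n : ℕ} (G : Graph n) (k : ℕ) (I J : Subset n) (ℓ : ℕ) : Set where
  field
    seq   : Fin (suc ℓ) → Subset n
    start : seq zero ≡ I
    end   : seq (fromℕ ℓ) ≡ J
    indep : ∀ i → Independent G (seq i)
    step  : ∀ (i : Fin ℓ) → TJAdjacent k (seq (inject₁ i)) (seq (suc i))

Reconfigurable : ∀ {n} → Graph n → ℕ → Subset n → Subset n → Set
Reconfigurable G k I J = Σ ℕ (ReconfSeq G k I J)

-- Jumping from each set of a reconfiguration sequence straight to the last later set it is
-- k-TJ-adjacent to yields a sequence in which sets two or more steps apart are never adjacent.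
-- Two s-sets that are not k-TJ-adjacent share fewer than μ = s − k elements, so the
-- even-indexed sets of such a sequence, about half of them, form a family of s-subsets of
-- an n-set with pairwise intersections below μ.  Such a family has at most n^μ / (s − μ)^μ
-- members: the members through a vertex v, with v deleted, form a family for μ − 1, and
-- double counting the incidences sums these bounds over the n vertices.

module Submission where

open import Defs hiding (sym)
open import Data.Nat.Base using (ℕ; zero; suc; _+_; _*_; _∸_; _^_; _≤_; _<_; z≤n; s≤s; s<s⁻¹)
open import Data.Nat.Properties
  using ( _≟_; _≤?_; ≤-refl; ≤-trans; ≤-reflexive; ≰⇒>; n≤1+n; m∸n≤m; suc-injective
        ; +-suc; +-identityʳ; +-mono-≤; +-monoʳ-≤; *-suc; *-zeroʳ; *-assoc; *-monoˡ-≤; *-monoʳ-≤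
        ; *-distribˡ-∸; m+n≤o⇒m≤o∸n; +-*-semiring; module ≤-Reasoning)
open import Data.Bool.Base using (true; false; if_then_else_)
open import Data.Fin.Base using (Fin; zero; suc; fromℕ; inject₁)
open import Data.Fin.Subset using (Subset; inside; outside; _∈_; _∩_; _─_; _-_; ⁅_⁆; ∣_∣)
open import Data.Fin.Subset.Properties using (_∈?_; p─⊥≡p; x∈p∩q⁺)
open import Data.Vec.Base using ([]; _∷_; here; there)
open import Data.List.Base using (List; []; _∷_; length; map; filter; lookup; tabulate)
open import Data.List.Relation.Unary.All as All using (All; []; _∷_)
open import Data.List.Relation.Unary.All.Properties as All using (anti-mono; all-filter; tabulate⁺)
open import Data.List.Relation.Unary.AllPairs using (AllPairs; []; _∷_)
import Data.List.Relation.Unary.AllPairs.Properties as AllPairs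
open import Data.List.Relation.Unary.Any using (there)
open import Data.List.Relation.Binary.Subset.Propositional using (_⊆_)
open import Data.List.Relation.Binary.Subset.Propositional.Properties using (⊆-refl; ∷⁺ʳ)
open import Data.List.Membership.Propositional.Properties using (∈-lookup)
open import Algebra.Properties.Semiring.Sum +-*-semiring using (sum-syntax; sum-replicate-zero; sum-cong-≗; ∑-distrib-+; *-distribʳ-sum)
open import Data.Product.Base using (Σ; Σ-syntax; _×_; _,_)
open import Data.Sum.Base using (_⊎_; inj₁; inj₂)
open import Function.Base using (_∘_)
open import Level using (_⊔_)
open import Relation.Binary.Core using (Rel)
open import Relation.Binary.Definitions using (Decidable)
open import Relation.Binary.Construct.Closure.ReflexiveTransitive using (Star; ε; _◅_)
open import Relation.Binary.PropositionalEquality using (_≡_; refl; sym; trans; cong; cong₂; subst; module ≡-Reasoning)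
open import Relation.Nullary using (¬_; yes; no; does)
open import Relation.Nullary.Decidable using (_×-dec_)

∑-≤ : ∀ {n} (f : Fin n → ℕ) {b} → (∀ i → f i ≤ b) → ∑[ i < n ] f i ≤ n * b
∑-≤ {zero} f f≤b = z≤n
∑-≤ {suc n} f f≤b = +-mono-≤ (f≤b zero) (∑-≤ (f ∘ suc) (f≤b ∘ suc))

AllPairs-map-All : ∀ {a p r s} {A : Set a} {P : A → Set p} {R : Rel A r} {S : Rel A s} →
                   (∀ {x y} → P x → P y → R x y → S x y) →
                   ∀ {xs} → All P xs → AllPairs R xs → AllPairs S xs
AllPairs-map-All f [] [] = []
AllPairs-map-All f (px ∷ pxs) (rx ∷ rxs) =
  All.zipWith (λ (py , r) → f px py r) (pxs , rx) ∷ AllPairs-map-All f pxs rxs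

∣p-x∣+1≡∣p∣ : ∀ {n} {p : Subset n} {x} → x ∈ p → suc ∣ p - x ∣ ≡ ∣ p ∣
∣p-x∣+1≡∣p∣ {p = inside ∷ p} here = cong (suc ∘ ∣_∣) (p─⊥≡p p)
∣p-x∣+1≡∣p∣ {p = inside ∷ p} (there x∈p) = cong suc (∣p-x∣+1≡∣p∣ x∈p)
∣p-x∣+1≡∣p∣ {p = outside ∷ p} (there x∈p) = ∣p-x∣+1≡∣p∣ x∈p

∩-distribʳ-─ : ∀ {n} (p q r : Subset n) → (p ─ r) ∩ (q ─ r) ≡ (p ∩ q) ─ r
∩-distribʳ-─ [] [] [] = refl
∩-distribʳ-─ (x ∷ p) (y ∷ q) (inside ∷ r) = cong (outside ∷_) (∩-distribʳ-─ p q r)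
∩-distribʳ-─ (x ∷ p) (y ∷ q) (outside ∷ r) = cong (_ ∷_) (∩-distribʳ-─ p q r)

∣p△q∣+2∣p∩q∣≡∣p∣+∣q∣ : ∀ {n} (p q : Subset n) → ∣ p △ q ∣ + 2 * ∣ p ∩ q ∣ ≡ ∣ p ∣ + ∣ q ∣
∣p△q∣+2∣p∩q∣≡∣p∣+∣q∣ [] [] = refl
∣p△q∣+2∣p∩q∣≡∣p∣+∣q∣ (inside ∷ p) (inside ∷ q) = begin
  d + 2 * suc m          ≡⟨ cong (d +_) (*-suc 2 m) ⟩
  d + (2 + 2 * m)        ≡⟨ +-suc d _ ⟩
  suc (d + suc (2 * m))  ≡⟨ cong suc (+-suc d _) ⟩
  2 + (d + 2 * m)        ≡⟨ cong (2 +_) (∣p△q∣+2∣p∩q∣≡∣p∣+∣q∣ p q) ⟩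
  2 + (∣ p ∣ + ∣ q ∣)    ≡⟨ cong suc (+-suc ∣ p ∣ ∣ q ∣) ⟨
  suc ∣ p ∣ + suc ∣ q ∣  ∎
  where
  open ≡-Reasoning
  d m : ℕ
  d = ∣ p △ q ∣
  m = ∣ p ∩ q ∣
∣p△q∣+2∣p∩q∣≡∣p∣+∣q∣ (inside ∷ p) (outside ∷ q) = cong suc (∣p△q∣+2∣p∩q∣≡∣p∣+∣q∣ p q)
∣p△q∣+2∣p∩q∣≡∣p∣+∣q∣ (outside ∷ p) (inside ∷ q) =
  trans (cong suc (∣p△q∣+2∣p∩q∣≡∣p∣+∣q∣ p q)) (sym (+-suc ∣ p ∣ ∣ q ∣))
∣p△q∣+2∣p∩q∣≡∣p∣+∣q∣ (outside ∷ p) (outside ∷ q) = ∣p△q∣+2∣p∩q∣≡∣p∣+∣q∣ p q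

¬TJAdjacent⇒∣p∩q∣<μ : ∀ {n} μ {s} {p q : Subset n} → ∣ p ∣ ≡ s → ∣ q ∣ ≡ s →
                      ¬ TJAdjacent (s ∸ μ) p q → ∣ p ∩ q ∣ < μ
¬TJAdjacent⇒∣p∩q∣<μ μ {p = p} {q} refl ∣q∣≡∣p∣ ¬adj = ≰⇒> λ μ≤∣p∩q∣ → ¬adj (sym ∣q∣≡∣p∣ , close μ≤∣p∩q∣)
  where
  open ≤-Reasoning
  ∣p△q∣+2μ≤2∣p∣ : μ ≤ ∣ p ∩ q ∣ → ∣ p △ q ∣ + 2 * μ ≤ 2 * ∣ p ∣
  ∣p△q∣+2μ≤2∣p∣ μ≤∣p∩q∣ = begin
    ∣ p △ q ∣ + 2 * μ          ≤⟨ +-monoʳ-≤ ∣ p △ q ∣ (*-monoʳ-≤ 2 μ≤∣p∩q∣) ⟩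
    ∣ p △ q ∣ + 2 * ∣ p ∩ q ∣  ≡⟨ ∣p△q∣+2∣p∩q∣≡∣p∣+∣q∣ p q ⟩
    ∣ p ∣ + ∣ q ∣              ≡⟨ cong (∣ p ∣ +_) (trans ∣q∣≡∣p∣ (sym (+-identityʳ ∣ p ∣))) ⟩
    2 * ∣ p ∣                  ∎
  close : μ ≤ ∣ p ∩ q ∣ → ∣ p △ q ∣ ≤ 2 * (∣ p ∣ ∸ μ)
  close μ≤∣p∩q∣ = begin
    ∣ p △ q ∣          ≤⟨ m+n≤o⇒m≤o∸n ∣ p △ q ∣ (∣p△q∣+2μ≤2∣p∣ μ≤∣p∩q∣) ⟩
    2 * ∣ p ∣ ∸ 2 * μ  ≡⟨ *-distribˡ-∸ 2 ∣ p ∣ μ ⟨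
    2 * (∣ p ∣ ∸ μ)    ∎

restrict : ∀ {n} → Fin n → List (Subset n) → List (Subset n)
restrict v F = map (_- v) (filter (v ∈?_) F)

restrict-uniform : ∀ {n s} (v : Fin n) {F} → All (λ A → ∣ A ∣ ≡ suc s) F →
                   All (λ A → ∣ A ∣ ≡ s) (restrict v F)
restrict-uniform v {F} uniform =
  All.map⁺ (All.map (λ (v∈A , ∣A∣≡1+s) → suc-injective (trans (∣p-x∣+1≡∣p∣ v∈A) ∣A∣≡1+s))
                    (All.zip (all-filter (v ∈?_) F , All.filter⁺ (v ∈?_) uniform)))

restrict-sparse : ∀ {n μ} (v : Fin n) {F} → AllPairs (λ A B → ∣ A ∩ B ∣ < suc μ) F →
                  AllPairs (λ A B → ∣ A ∩ B ∣ < μ) (restrict v F)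
restrict-sparse {μ = μ} v {F} sparse =
  AllPairs.map⁺ (AllPairs-map-All shrink (all-filter (v ∈?_) F) (AllPairs.filter⁺ (v ∈?_) sparse))
  where
  shrink : ∀ {A B} → v ∈ A → v ∈ B → ∣ A ∩ B ∣ < suc μ → ∣ (A - v) ∩ (B - v) ∣ < μ
  shrink {A} {B} v∈A v∈B ∣A∩B∣<1+μ rewrite ∩-distribʳ-─ A B ⁅ v ⁆ =
    s<s⁻¹ (subst (_< suc μ) (sym (∣p-x∣+1≡∣p∣ (x∈p∩q⁺ (v∈A , v∈B)))) ∣A∩B∣<1+μ)

∑-indicator≡∣p∣ : ∀ {n} (p : Subset n) → ∑[ v < n ] (if does (v ∈? p) then 1 else 0) ≡ ∣ p ∣
∑-indicator≡∣p∣ [] = refl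
∑-indicator≡∣p∣ (inside ∷ p) = cong suc (∑-indicator≡∣p∣ p)
∑-indicator≡∣p∣ (outside ∷ p) = ∑-indicator≡∣p∣ p

length-restrict-∷ : ∀ {n} (v : Fin n) A F →
                    length (restrict v (A ∷ F)) ≡ (if does (v ∈? A) then 1 else 0) + length (restrict v F)
length-restrict-∷ v A F with does (v ∈? A)
... | true = refl
... | false = refl

∑-length-restrict : ∀ {n s} {F : List (Subset n)} → All (λ A → ∣ A ∣ ≡ s) F →
                    ∑[ v < n ] length (restrict v F) ≡ length F * s
∑-length-restrict {n} [] = sum-replicate-zero n
∑-length-restrict {n} {F = A ∷ F} (refl ∷ uniform) = begin
  ∑[ v < n ] length (restrict v (A ∷ F))
    ≡⟨ sum-cong-≗ (λ v → length-restrict-∷ v A F) ⟩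
  ∑[ v < n ] ((if does (v ∈? A) then 1 else 0) + length (restrict v F))
    ≡⟨ ∑-distrib-+ (λ v → if does (v ∈? A) then 1 else 0) (λ v → length (restrict v F)) ⟩
  ∑[ v < n ] (if does (v ∈? A) then 1 else 0) + ∑[ v < n ] length (restrict v F)
    ≡⟨ cong₂ _+_ (∑-indicator≡∣p∣ A) (∑-length-restrict uniform) ⟩
  ∣ A ∣ + length F * ∣ A ∣ ∎
  where open ≡-Reasoning

sparse-family-length-bound : ∀ {n} μ {s} (F : List (Subset n)) →
                             All (λ A → ∣ A ∣ ≡ s) F → AllPairs (λ A B → ∣ A ∩ B ∣ < μ) F →
                             length F * (s ∸ μ) ^ μ ≤ n ^ μ
sparse-family-length-bound zero [] _ _ = z≤n
sparse-family-length-bound zero (A ∷ []) _ _ = ≤-refl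
sparse-family-length-bound zero (A ∷ B ∷ F) _ ((() ∷ _) ∷ _)
sparse-family-length-bound (suc μ) {zero} F _ _ = ≤-trans (≤-reflexive (*-zeroʳ (length F))) z≤n
sparse-family-length-bound {n} (suc μ) {suc s} F uniform sparse = begin
  length F * ((s ∸ μ) * K)                 ≤⟨ *-monoʳ-≤ (length F) (*-monoˡ-≤ K s∸μ≤1+s) ⟩
  length F * (suc s * K)                   ≡⟨ *-assoc (length F) (suc s) K ⟨
  length F * suc s * K                     ≡⟨ cong (_* K) (∑-length-restrict uniform) ⟨
  (∑[ v < n ] length (restrict v F)) * K   ≡⟨ *-distribʳ-sum K (λ v → length (restrict v F)) ⟩
  ∑[ v < n ] (length (restrict v F) * K)   ≤⟨ ∑-≤ _ through ⟩
  n * n ^ μ                                ∎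
  where
  open ≤-Reasoning
  K : ℕ
  K = (s ∸ μ) ^ μ
  s∸μ≤1+s : s ∸ μ ≤ suc s
  s∸μ≤1+s = ≤-trans (m∸n≤m s μ) (n≤1+n s)
  through : ∀ v → length (restrict v F) * K ≤ n ^ μ
  through v = sparse-family-length-bound μ (restrict v F) (restrict-uniform v uniform) (restrict-sparse v sparse)

module _ {a r} {A : Set a} {R : Rel A r} where

  points : ∀ {x y} → Star R x y → List A
  points ε = []
  points (_◅_ {j = y} _ p) = y ∷ points p

  vertices : ∀ {x y} → Star R x y → List A
  vertices {x} p = x ∷ points p

  -- No vertex is related to a vertex two or more steps further along the path.
  data ShortcutFree : ∀ {x y} → Star R x y → Set (a ⊔ r) where
    ε   : ∀ {x} → ShortcutFree (ε {x = x})
    _◅_ : ∀ {x y z} {xRy : R x y} {p : Star R y z} →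
          All (λ w → ¬ R x w) (points p) → ShortcutFree p → ShortcutFree (xRy ◅ p)

  vertices-All : ∀ {p} {P : A → Set p} → (∀ {u w} → R u w → P u → P w) →
                 ∀ {x y} → P x → (p : Star R x y) → All P (vertices p)
  vertices-All preserve Px ε = Px ∷ []
  vertices-All preserve Px (xRy ◅ p) = Px ∷ vertices-All preserve (preserve xRy Px) p

  record LastHit (x : A) {y z} (p : Star R y z) : Set (a ⊔ r) where
    constructor hit
    field
      {target}    : A
      edge        : R x target
      rest        : Star R target z
      rest-free   : ShortcutFree rest
      rest-misses : All (λ w → ¬ R x w) (points rest)
      rest⊆       : vertices rest ⊆ points p

  lastHit : Decidable R → ∀ x {y z} (p : Star R y z) → ShortcutFree p →
            LastHit x p ⊎ All (λ w → ¬ R x w) (points p)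
  lastHit R? x ε ε = inj₂ []
  lastHit R? x (_◅_ {j = w} _ p) (_ ◅ free) with lastHit R? x p free
  ... | inj₁ (hit xRu q q-free q-misses q⊆) = inj₁ (hit xRu q q-free q-misses (there ∘ q⊆))
  ... | inj₂ misses with R? x w
  ...   | yes xRw = inj₁ (hit xRw p free misses ⊆-refl)
  ...   | no ¬xRw = inj₂ (¬xRw ∷ misses)

  removeShortcuts : Decidable R → ∀ {x y} (p : Star R x y) →
                    Σ[ q ∈ Star R x y ] ShortcutFree q × points q ⊆ points p
  removeShortcuts R? ε = ε , ε , ⊆-refl
  removeShortcuts R? {x} (_◅_ {j = y} xRy p) with removeShortcuts R? p
  ... | q , free , q⊆p with lastHit R? x q free
  ...   | inj₁ (hit xRw rest rest-free misses rest⊆) = xRw ◅ rest , misses ◅ rest-free , there ∘ q⊆p ∘ rest⊆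
  ...   | inj₂ misses = xRy ◅ q , misses ◅ free , ∷⁺ʳ y q⊆p

  evens : ∀ {x y} → Star R x y → List A
  evens {x} ε = x ∷ []
  evens {x} (_ ◅ ε) = x ∷ []
  evens {x} (_ ◅ _ ◅ p) = x ∷ evens p

  evens⊆vertices : ∀ {x y} (p : Star R x y) → evens p ⊆ vertices p
  evens⊆vertices ε = ⊆-refl
  evens⊆vertices (_ ◅ ε) = ∷⁺ʳ _ λ ()
  evens⊆vertices (_ ◅ _ ◅ p) = ∷⁺ʳ _ (there ∘ evens⊆vertices p)

  evens-unrelated : ∀ {x y} {p : Star R x y} → ShortcutFree p → AllPairs (λ u w → ¬ R u w) (evens p)
  evens-unrelated ε = [] ∷ []
  evens-unrelated (_ ◅ ε) = [] ∷ []
  evens-unrelated {p = _ ◅ _ ◅ p} (misses ◅ _ ◅ free) =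
    anti-mono (evens⊆vertices p) misses ∷ evens-unrelated free

  length-points≤2*length-evens : ∀ {x y} (p : Star R x y) → length (points p) ≤ 2 * length (evens p)
  length-points≤2*length-evens ε = z≤n
  length-points≤2*length-evens (_ ◅ ε) = s≤s z≤n
  length-points≤2*length-evens (_ ◅ _ ◅ p) =
    ≤-trans (+-monoʳ-≤ 2 (length-points≤2*length-evens p)) (≤-reflexive (sym (*-suc 2 (length (evens p)))))

  fromFin : ∀ {ℓ} (f : Fin (suc ℓ) → A) → (∀ i → R (f (inject₁ i)) (f (suc i))) →
            Star R (f zero) (f (fromℕ ℓ))
  fromFin {zero} f steps = ε
  fromFin {suc ℓ} f steps = steps zero ◅ fromFin (f ∘ suc) (steps ∘ suc)

  vertices-fromFin : ∀ {ℓ} (f : Fin (suc ℓ) → A) steps → vertices (fromFin f steps) ≡ tabulate f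
  vertices-fromFin {zero} f steps = refl
  vertices-fromFin {suc ℓ} f steps = cong (f zero ∷_) (vertices-fromFin (f ∘ suc) (steps ∘ suc))

  lookup-vertices-last : ∀ {x y} (p : Star R x y) → lookup (vertices p) (fromℕ (length (points p))) ≡ y
  lookup-vertices-last ε = refl
  lookup-vertices-last (_ ◅ p) = lookup-vertices-last p

  lookup-vertices-step : ∀ {x y} (p : Star R x y) (i : Fin (length (points p))) →
                         R (lookup (vertices p) (inject₁ i)) (lookup (vertices p) (suc i))
  lookup-vertices-step (xRy ◅ p) zero = xRy
  lookup-vertices-step (_ ◅ p) (suc i) = lookup-vertices-step p i

module _ {n} (G : Graph n) (k : ℕ) where

  toReconfSeq : ∀ {I J} (p : Star (TJAdjacent k) I J) → All (Independent G) (vertices p) →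
                ReconfSeq G k I J (length (points p))
  toReconfSeq p independent = record
    { seq   = lookup (vertices p)
    ; start = refl
    ; end   = lookup-vertices-last p
    ; indep = λ i → All.lookup independent (∈-lookup i)
    ; step  = lookup-vertices-step p
    }

  fromReconfSeq : ∀ {I J ℓ} → ReconfSeq G k I J ℓ →
                  Σ[ p ∈ Star (TJAdjacent k) I J ] All (Independent G) (vertices p)
  fromReconfSeq record { seq = f ; start = refl ; end = refl ; indep = independent ; step = steps } =
    fromFin f steps , subst (All (Independent G)) (sym (vertices-fromFin f steps)) (tabulate⁺ independent)

TJAdjacent? : ∀ {n} k → Decidable (TJAdjacent {n} k)
TJAdjacent? k A B = (∣ A ∣ ≟ ∣ B ∣) ×-dec (∣ A △ B ∣ ≤? 2 * k)

shortcutFree-length-bound : ∀ {n} μ {I J : Subset n} (p : Star (TJAdjacent (∣ I ∣ ∸ μ)) I J) →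
                            ShortcutFree p → length (points p) * (∣ I ∣ ∸ μ) ^ μ ≤ 2 * n ^ μ
shortcutFree-length-bound {n} μ {I} p free = begin
  length (points p) * K       ≤⟨ *-monoˡ-≤ K (length-points≤2*length-evens p) ⟩
  2 * length (evens p) * K    ≡⟨ *-assoc 2 (length (evens p)) K ⟩
  2 * (length (evens p) * K)  ≤⟨ *-monoʳ-≤ 2 (sparse-family-length-bound μ (evens p) uniform sparse) ⟩
  2 * n ^ μ                   ∎
  where
  open ≤-Reasoning
  K : ℕ
  K = (∣ I ∣ ∸ μ) ^ μ
  uniform : All (λ A → ∣ A ∣ ≡ ∣ I ∣) (evens p)
  uniform = anti-mono (evens⊆vertices p) (vertices-All (λ (∣u∣≡∣w∣ , _) → trans (sym ∣u∣≡∣w∣)) refl p)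
  sparse : AllPairs (λ A B → ∣ A ∩ B ∣ < μ) (evens p)
  sparse = AllPairs-map-All (λ {A} {B} → ¬TJAdjacent⇒∣p∩q∣<μ μ {p = A} {B}) uniform (evens-unrelated free)

lemma5 : (μ : ℕ) → Σ ℕ λ C →
    ∀ (n : ℕ) (G : Graph n) (I J : Subset n) →
    Independent G I → Independent G J → ∣ I ∣ ≡ ∣ J ∣ → μ < ∣ I ∣ →
    Reconfigurable G (∣ I ∣ ∸ μ) I J →
    Σ ℕ λ ℓ → ReconfSeq G (∣ I ∣ ∸ μ) I J ℓ ×
    (ℓ * (∣ I ∣ ∸ μ) ^ μ ≤ C * n ^ μ)
lemma5 μ = 2 , λ n G I J _ _ _ _ (_ , σ) →
  let k = ∣ I ∣ ∸ μ
      p , independent = fromReconfSeq G k σ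
      q , free , q⊆p = removeShortcuts (TJAdjacent? k) p
  in length (points q) ,
     toReconfSeq G k q (anti-mono (∷⁺ʳ I q⊆p) independent) ,
     shortcutFree-length-bound μ q free
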